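{- Let $G$ be a 2-connected outerplane bipartite graph. For $M\in\mathcal{M}(G)$ let $\sigma(M)$ be the set of inner faces of $G$ contained in the interior of some cycle of $M\oplus M^{\hat0}$. Then for every $M$, $\sigma(M)$ is an order ideal of $\mathbf{F}(G)$, and the map $\sigma:\mathcal{M}(G)\to J(\mathbf{F}(G))$ is injective.
   Context: A connected plane graph is outerplane if all vertices lie on the boundary of the outer face. Fix a proper white/black coloring. Orient the dual $G^*$: the dual edge $e^*$ goes from $f_1^*$ to $f_2^*$ if, going along $e^*$ from $f_1^*$ to $f_2^*$, the white end-vertex of $e$ lies on the right; deleting the vertex of the outer face gives $\vec G^\#$. $\mathbf{F}(G)$ is the poset on inner faces with $f_1\preceq f_2$ iff $\vec G^\#$ has a directed path from $f_2^*$ to $f_1^*$; $J(\mathbf{F}(G))$ is its set of order ideals (down-sets). A 1-factor is a perfect matching, $\mathcal{M}(G)$ the set of them; for $M\in\mathcal{M}(G)$ a cycle is $M$-alternating if its edges alternate in/out of $M$, and proper if each of its edges in $M$ goes from white to black end-vertex along the clockwise orientation. $\vec Z(G)$ has vertex set $\mathcal{M}(G)$ and an arc $M_1\to M_2$ when $M_1\oplus M_2$ bounds an inner face and is a proper $M_1$-alternating cycle; $\mathbf{M}(G)$ is the poset with $M_1\preceq M_2$ iff there is a directed path from $M_2$ to $M_1$; it is a finite distributive lattice with least element $M^{\hat0}$. -}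

module Defs where

-- Combinatorial model of a 2-connected outerplane graph:
-- vertices are Fin n, listed 0,1,...,n-1 in CLOCKWISE order along the
-- boundary of the outer face (which is a Hamiltonian cycle); all other
-- edges are chords drawn inside this cycle without crossings.

open import Data.Nat as ℕ using (ℕ; suc; zero)
open import Data.Fin as Fin using (Fin; toℕ; _<_)
open import Data.Fin.Subset using (Subset; _∈_; ∣_∣)
open import Data.Bool using (Bool; true; false)
open import Data.Product using (Σ; ∃; ∃-syntax; _×_; _,_)
open import Data.Sum using (_⊎_)
open import Relation.Binary.PropositionalEquality using (_≡_; _≢_)
open import Relation.Nullary using (¬_; yes; no)
open import Relation.Binary.Construct.Closure.ReflexiveTransitive using (Star)
open import Function.Bundles using (_⇔_)

OuterSucc : ∀ {n} → Fin n → Fin n → Set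
OuterSucc {n} u v = (suc (toℕ u) ≡ toℕ v) ⊎ (suc (toℕ u) ≡ n × toℕ v ≡ 0)

record Outerplane2Conn (n : ℕ) : Set₁ where
  field
    Adj        : Fin n → Fin n → Set
    three≤n    : 3 ℕ.≤ n
    adj-sym    : ∀ {u v} → Adj u v → Adj v u
    adj-irrefl : ∀ {u} → ¬ Adj u u
    outer      : ∀ u v → OuterSucc u v → Adj u v
    noncross   : ∀ {a b c d} → Adj a b → Adj c d → ¬ (a < c × c < b × b < d)

BetweenCW : ∀ {n} → Fin n → Fin n → Fin n → Set
BetweenCW u w v = (u < v × u < w × w < v) ⊎ (v < u × (u < w ⊎ w < v))

Xor : Set → Set → Set
Xor A B = (A × ¬ B) ⊎ (¬ A × B)

cycSuc : ∀ {k} → Fin (suc k) → Fin (suc k)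
cycSuc {k} i with suc (toℕ i) ℕ.<? suc k
... | yes p = Fin.fromℕ< p
... | no _  = Fin.zero

record PerfectMatching {n} (G : Outerplane2Conn n) : Set where
  open Outerplane2Conn G
  field
    partner : Fin n → Fin n
    partner-adj : ∀ u → Adj u (partner u)
    partner-invol : ∀ u → partner (partner u) ≡ u
open PerfectMatching public

module _ {n : ℕ} (G : Outerplane2Conn n) (white : Fin n → Bool) where
  open Outerplane2Conn G

  ProperColoring : Set
  ProperColoring = ∀ {u v} → Adj u v → white u ≢ white v

  -- u → v is an edge of the clockwise boundary walk of the vertex set S
  Consecutive : Subset n → Fin n → Fin n → Set
  Consecutive S u v = u ∈ S × v ∈ S × u ≢ v × (∀ w → w ∈ S → ¬ BetweenCW u w v)

  Separates : Fin n → Fin n → Subset n → Set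
  Separates a b S = ∃[ s ] ∃[ t ] (s ∈ S × t ∈ S × BetweenCW a s b × BetweenCW b t a)

  IsInnerFace : Subset n → Set
  IsInnerFace S = 3 ℕ.≤ ∣ S ∣
                × (∀ u v → Consecutive S u v → Adj u v)
                × (∀ a b → Adj a b → ¬ Separates a b S)

  -- arc f* → g* of G⃗#: the common edge is traversed u → v clockwise around f
  -- (so v → u clockwise around g); going from f to g the end v is on the right
  DualArc : Subset n → Subset n → Set
  DualArc f g = IsInnerFace f × IsInnerFace g ×
    ∃[ u ] ∃[ v ] (Adj u v × Consecutive f u v × Consecutive g v u × white v ≡ true)

  _⪯F_ : Subset n → Subset n → Set
  f₁ ⪯F f₂ = Star DualArc f₂ f₁

  IsOrderIdeal : (Subset n → Set) → Set
  IsOrderIdeal I = (∀ S → I S → IsInnerFace S)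
                 × (∀ f₁ f₂ → I f₂ → f₁ ⪯F f₂ → I f₁)

  InM : PerfectMatching G → Fin n → Fin n → Set
  InM M u v = partner M u ≡ v

  SymDiff : PerfectMatching G → PerfectMatching G → Fin n → Fin n → Set
  SymDiff M₁ M₂ u v = Xor (InM M₁ u v) (InM M₂ u v)

  ZArc : PerfectMatching G → PerfectMatching G → Set
  ZArc M₁ M₂ = ∃[ f ] (IsInnerFace f
    × (∀ u v → SymDiff M₁ M₂ u v ⇔ (Consecutive f u v ⊎ Consecutive f v u))
    × (∀ u v w → Consecutive f u v → Consecutive f v w → Xor (InM M₁ u v) (InM M₁ v w))
    × (∀ u v → Consecutive f u v → InM M₁ u v → white u ≡ true))

  _⪯M_ : PerfectMatching G → PerfectMatching G → Set
  M₁ ⪯M M₂ = Star ZArc M₂ M₁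

  IsLeast : PerfectMatching G → Set
  IsLeast M₀ = ∀ M → M₀ ⪯M M

  record SymDiffCycle (M₀ M : PerfectMatching G) : Set where
    field
      len    : ℕ
      vtx    : Fin (suc (suc (suc len))) → Fin n
      inj    : ∀ i j → vtx i ≡ vtx j → i ≡ j
      edges  : ∀ i → SymDiff M M₀ (vtx i) (vtx (cycSuc i))

  OnCycle : ∀ {M₀ M} → SymDiffCycle M₀ M → Fin n → Set
  OnCycle C x = ∃[ i ] (SymDiffCycle.vtx C i ≡ x)

  -- σ(M): inner faces lying in the interior of some cycle of M ⊕ M₀
  -- (an inner face lies inside a cycle C iff all its vertices lie on C)
  σ : PerfectMatching G → PerfectMatching G → Subset n → Set
  σ M₀ M S = IsInnerFace S × ∃[ C ] (∀ x → x ∈ S → OnCycle {M₀} {M} C x)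

-- The least matching M̂₀ is the outer one, which matches every black vertex to its
-- clockwise successor on the boundary: the outer matching's edge at a white vertex runs
-- against the clockwise orientation of every inner face, so no inner face is a proper
-- alternating cycle for it; it is a sink of Z(G), and M̂₀, lying below it, equals it.
--
-- Edges do not cross. For an edge of a cycle C of M ⊕ M̂₀, the rest of C is a walk that
-- avoids the ends of the edge, so all other vertices of C lie on one side of it. Hence if an
-- inner face has two consecutive boundary vertices a, b on C and a vertex of C lies on the
-- arc from b back to a, every vertex of the face lies on C: an off-cycle one would be
-- separated from the face by an edge of C. The M̂₀-partner of a vertex is its boundary
-- neighbour; it supplies such a vertex across the common edge of a dual arc, so σ(M) is
-- closed under the dual arcs, i.e. it is an order ideal.
--
-- Following M from white and M̂₀ from black vertices is a permutation; its orbit through a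
-- vertex u with M u ≠ M̂₀ u is a cycle of M ⊕ M̂₀. On a Z-path from M down to M̂₀ the edge
-- {u, M u} is flipped at a face having it as a boundary edge, and that face lies in σ(M).
-- So if σ(M) = σ(M′) but M u ≠ M′ u, some cycle of M′ ⊕ M̂₀ passes through u and M u and
-- some cycle of M ⊕ M̂₀ through u and M′ u; with the boundary neighbour M̂₀ u of u, which
-- lies on both, one of these cycles has vertices on both sides of its edge at u.

module Submission where

open import Defs
open import Data.Bool using (Bool; true; false; not)
open import Data.Bool.Properties using (¬-not; not-injective)
open import Data.Empty using (⊥; ⊥-elim)
open import Data.Fin as Fin using (Fin; toℕ; fromℕ<)
open import Data.Fin.Properties
  using (<-isStrictTotalOrder; <-asym; <-cmp; toℕ-injective; toℕ<n; toℕ-fromℕ; toℕ-fromℕ<; toℕ-inject₁; toℕ-inject;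
         any?; pigeonhole; ¬∀⟶∃¬-smallest)
open import Data.Fin.Subset using (Subset; _∈_; _⊆_; _∪_; ⁅_⁆; ∣_∣)
open import Data.Fin.Subset.Properties using (_∈?_; x∈⁅x⁆; x∈p∪q⁺; p⊆q⇒∣p∣≤∣q∣; ∣⁅x⁆∣≡1)
open import Data.Nat using (ℕ; suc; zero; _+_; _*_; _∸_; _≤_; _<_; z≤n; s≤s; NonZero)
import Data.Nat.Properties as ℕ
open import Data.Nat.DivMod
  using (_%_; _/_; _mod_; m<n⇒m%n≡m; n%n≡0; [m+n]%n≡m%n; m%n<n; %-distribˡ-+; m%n%n≡m%n; m≡m%n+[m/n]*n)
open import Data.Nat.Divisibility using (divides; ∣⇒≤) renaming (_∣_ to _∣ℕ_)
open import Data.Nat.GeneralisedArithmetic using (fold; fold-+)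
open import Data.Product using (Σ; ∃; _×_; _,_; proj₁; proj₂; swap)
open import Data.Sum using (_⊎_; inj₁; inj₂)
open import Data.Vec using ([]; _∷_)
open import Data.List using (List; []; _∷_; allFin)
open import Data.List.Relation.Unary.All as All using (All; []; _∷_)
open import Data.List.Membership.Propositional.Properties using (∈-allFin)
open import Function.Base using (_∘_; flip; id)
open import Function.Bundles using (_⇔_; Equivalence)
open import Relation.Binary.Core using (Rel)
open import Relation.Binary.Definitions using (tri<; tri≈; tri>)
open import Relation.Binary.Structures using (IsStrictTotalOrder)
open import Relation.Binary.Construct.Closure.ReflexiveTransitive using (Star; ε; _◅_)
open import Relation.Binary.PropositionalEquality using (_≡_; _≢_; refl; sym; trans; cong; cong₂; subst; module ≡-Reasoning)
open import Relation.Nullary using (¬_; Dec; yes; no; ¬?; contradiction)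
open import Relation.Nullary.Decidable using (_×-dec_; _⊎-dec_; decidable-stable)

module CyclicOrder {a ℓ} {A : Set a} {_<_ : Rel A ℓ} (sto : IsStrictTotalOrder _≡_ _<_) where
  open IsStrictTotalOrder sto using (compare; irrefl; asym; _<?_) renaming (trans to <-trans)

  private
    <-irrefl : ∀ {x} → ¬ x < x
    <-irrefl = irrefl refl

  -- Reading A as a cycle, x lies on the open arc from a to b.
  Between : A → A → A → Set ℓ
  Between a x b = (a < b × a < x × x < b) ⊎ (b < a × (a < x ⊎ x < b))

  between? : ∀ a x b → Dec (Between a x b)
  between? a x b = (a <? b ×-dec a <? x ×-dec x <? b) ⊎-dec (b <? a ×-dec (a <? x ⊎-dec x <? b))

  between-rotate : ∀ {a x b} → Between a x b → Between x b a
  between-rotate (inj₁ (_ , a<x , x<b)) = inj₂ (a<x , inj₁ x<b)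
  between-rotate (inj₂ (b<a , inj₁ a<x)) = inj₂ (a<x , inj₂ b<a)
  between-rotate (inj₂ (b<a , inj₂ x<b)) = inj₁ (<-trans x<b b<a , x<b , b<a)

  between-rotate² : ∀ {a x b} → Between a x b → Between b a x
  between-rotate² = between-rotate ∘ between-rotate

  between-asym : ∀ {a x b} → Between a x b → ¬ Between b x a
  between-asym (inj₁ (a<b , _)) (inj₁ (b<a , _)) = asym a<b b<a
  between-asym (inj₁ (_ , _ , x<b)) (inj₂ (_ , inj₁ b<x)) = asym x<b b<x
  between-asym (inj₁ (_ , a<x , _)) (inj₂ (_ , inj₂ x<a)) = asym a<x x<a
  between-asym (inj₂ (_ , inj₁ a<x)) (inj₁ (_ , _ , x<a)) = asym a<x x<a
  between-asym (inj₂ (_ , inj₂ x<b)) (inj₁ (_ , b<x , _)) = asym x<b b<x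
  between-asym (inj₂ (b<a , _)) (inj₂ (a<b , _)) = asym a<b b<a

  between-trans : ∀ {a b c d} → Between a b c → Between a c d → Between a b d
  between-trans (inj₁ (_ , a<b , b<c)) (inj₁ (a<d , _ , c<d)) = inj₁ (a<d , a<b , <-trans b<c c<d)
  between-trans (inj₁ (_ , a<b , _)) (inj₂ (d<a , inj₁ _)) = inj₂ (d<a , inj₁ a<b)
  between-trans (inj₁ (a<c , _)) (inj₂ (d<a , inj₂ c<d)) = ⊥-elim (<-irrefl (<-trans a<c (<-trans c<d d<a)))
  between-trans (inj₂ (c<a , _)) (inj₁ (_ , a<c , _)) = ⊥-elim (asym c<a a<c)
  between-trans (inj₂ (c<a , _)) (inj₂ (_ , inj₁ a<c)) = ⊥-elim (asym c<a a<c)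
  between-trans (inj₂ (_ , inj₁ a<b)) (inj₂ (d<a , inj₂ _)) = inj₂ (d<a , inj₁ a<b)
  between-trans (inj₂ (_ , inj₂ b<c)) (inj₂ (d<a , inj₂ c<d)) = inj₂ (d<a , inj₂ (<-trans b<c c<d))

  between⇒≢ˡ : ∀ {a x b} → Between a x b → a ≢ x
  between⇒≢ˡ (inj₁ (_ , a<x , _)) refl = <-irrefl a<x
  between⇒≢ˡ (inj₂ (_ , inj₁ a<x)) refl = <-irrefl a<x
  between⇒≢ˡ (inj₂ (b<a , inj₂ x<b)) refl = asym b<a x<b

  between⇒≢ʳ : ∀ {a x b} → Between a x b → x ≢ b
  between⇒≢ʳ p = between⇒≢ˡ (between-rotate p)

  between⇒≢ : ∀ {a x b} → Between a x b → a ≢ b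
  between⇒≢ p a≡b = between⇒≢ʳ (between-rotate p) (sym a≡b)

  between-total : ∀ {a x b} → a ≢ b → x ≢ a → x ≢ b → Between a x b ⊎ Between b x a
  between-total {a} {x} {b} a≢b x≢a x≢b with compare a b | compare x a | compare x b
  ... | tri≈ _ a≡b _ | _ | _ = ⊥-elim (a≢b a≡b)
  ... | _ | tri≈ _ x≡a _ | _ = ⊥-elim (x≢a x≡a)
  ... | _ | _ | tri≈ _ x≡b _ = ⊥-elim (x≢b x≡b)
  ... | tri< a<b _ _ | tri< x<a _ _ | _ = inj₂ (inj₂ (a<b , inj₂ x<a))
  ... | tri< a<b _ _ | tri> _ _ a<x | tri< x<b _ _ = inj₁ (inj₁ (a<b , a<x , x<b))
  ... | tri< a<b _ _ | tri> _ _ _ | tri> _ _ b<x = inj₂ (inj₂ (a<b , inj₁ b<x))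
  ... | tri> _ _ b<a | _ | tri< x<b _ _ = inj₁ (inj₂ (b<a , inj₂ x<b))
  ... | tri> _ _ b<a | tri< x<a _ _ | tri> _ _ b<x = inj₂ (inj₁ (b<a , b<x , x<a))
  ... | tri> _ _ b<a | tri> _ _ a<x | tri> _ _ _ = inj₁ (inj₂ (b<a , inj₁ a<x))

  between-trans′ : ∀ {a b c d} → Between a b c → Between a c d → Between b c d
  between-trans′ {b = b} {c} {d} abc acd with between-total b≢d (between⇒≢ʳ abc ∘ sym) (between⇒≢ʳ acd)
    where
    b≢d : b ≢ d
    b≢d refl = between-asym abc (between-rotate acd)
  ... | inj₁ bcd = bcd
  ... | inj₂ dcb = ⊥-elim (between-asym abc (between-trans (between-rotate dcb) (between-rotate acd)))

  between-split : ∀ {a x b y} → Between a x b → Between a y b → y ≢ x → Between a y x ⊎ Between x y b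
  between-split axb ayb y≢x with between-total (between⇒≢ʳ axb) y≢x (between⇒≢ʳ ayb)
  ... | inj₁ xyb = inj₂ xyb
  ... | inj₂ byx = inj₁ (between-rotate² (between-trans (between-rotate byx) (between-rotate ayb)))

  between-interleave : ∀ {x s a t} → Between x s a → Between a t x → Between t x s × Between s a t
  between-interleave xsa atx =
    between-trans′ atx (between-rotate² xsa) , between-rotate² (between-trans atx (between-rotate² xsa))

∣p∪q∣≤∣p∣+∣q∣ : ∀ {n} (p q : Subset n) → ∣ p ∪ q ∣ ≤ (∣ p ∣ + ∣ q ∣)
∣p∪q∣≤∣p∣+∣q∣ [] [] = z≤n
∣p∪q∣≤∣p∣+∣q∣ (false ∷ p) (false ∷ q) = ∣p∪q∣≤∣p∣+∣q∣ p q
∣p∪q∣≤∣p∣+∣q∣ (false ∷ p) (true ∷ q) =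
  ℕ.≤-trans (s≤s (∣p∪q∣≤∣p∣+∣q∣ p q)) (ℕ.≤-reflexive (sym (ℕ.+-suc ∣ p ∣ ∣ q ∣)))
∣p∪q∣≤∣p∣+∣q∣ (true ∷ p) (false ∷ q) = s≤s (∣p∪q∣≤∣p∣+∣q∣ p q)
∣p∪q∣≤∣p∣+∣q∣ (true ∷ p) (true ∷ q) =
  s≤s (ℕ.≤-trans (∣p∪q∣≤∣p∣+∣q∣ p q) (ℕ.≤-trans (ℕ.n≤1+n _) (ℕ.≤-reflexive (sym (ℕ.+-suc ∣ p ∣ ∣ q ∣)))))

∣⁅x⁆∪⁅y⁆∣≤2 : ∀ {n} (x y : Fin n) → ∣ ⁅ x ⁆ ∪ ⁅ y ⁆ ∣ ≤ 2
∣⁅x⁆∪⁅y⁆∣≤2 x y =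
  ℕ.≤-trans (∣p∪q∣≤∣p∣+∣q∣ ⁅ x ⁆ ⁅ y ⁆) (ℕ.≤-reflexive (cong₂ _+_ (∣⁅x⁆∣≡1 x) (∣⁅x⁆∣≡1 y)))

∃-∉⁅x,y⁆ : ∀ {n} {S : Subset n} → 3 ≤ ∣ S ∣ → ∀ x y → ∃ λ z → z ∈ S × z ≢ x × z ≢ y
∃-∉⁅x,y⁆ {S = S} 3≤∣S∣ x y with any? (λ z → z ∈? S ×-dec ¬? (z Fin.≟ x) ×-dec ¬? (z Fin.≟ y))
... | yes found = found
... | no none =
  contradiction (ℕ.≤-trans 3≤∣S∣ (ℕ.≤-trans (p⊆q⇒∣p∣≤∣q∣ S⊆⁅x,y⁆) (∣⁅x⁆∪⁅y⁆∣≤2 x y))) λ { (s≤s (s≤s ())) }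
  where
  S⊆⁅x,y⁆ : S ⊆ ⁅ x ⁆ ∪ ⁅ y ⁆
  S⊆⁅x,y⁆ {z} z∈S with z Fin.≟ x | z Fin.≟ y
  ... | yes refl | _ = x∈p∪q⁺ (inj₁ (x∈⁅x⁆ z))
  ... | no _ | yes refl = x∈p∪q⁺ (inj₂ (x∈⁅x⁆ z))
  ... | no z≢x | no z≢y = contradiction (z , z∈S , z≢x , z≢y) none

Xor⇒⊎ : ∀ {A B : Set} → Xor A B → A ⊎ B
Xor⇒⊎ (inj₁ (a , _)) = inj₁ a
Xor⇒⊎ (inj₂ (_ , b)) = inj₂ b

pair-exhausted : ∀ {A : Set} {p q x y z : A} → p ≡ x ⊎ q ≡ x → p ≡ z ⊎ q ≡ z → x ≢ z →
                 p ≡ y ⊎ q ≡ y → y ≡ x ⊎ y ≡ z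
pair-exhausted (inj₁ refl) (inj₁ refl) x≢z _ = contradiction refl x≢z
pair-exhausted (inj₁ refl) (inj₂ refl) _ (inj₁ refl) = inj₁ refl
pair-exhausted (inj₁ refl) (inj₂ refl) _ (inj₂ refl) = inj₂ refl
pair-exhausted (inj₂ refl) (inj₁ refl) _ (inj₁ refl) = inj₂ refl
pair-exhausted (inj₂ refl) (inj₁ refl) _ (inj₂ refl) = inj₁ refl
pair-exhausted (inj₂ refl) (inj₂ refl) x≢z _ = contradiction refl x≢z

<⇒∃-offset : ∀ {i j} → i < j → ∃ λ d → suc i + d ≡ j
<⇒∃-offset {i} {j} i<j = j ∸ suc i , ℕ.m+[n∸m]≡n i<j

[m+n]%o≡[m%o+n]%o : ∀ m n o .{{_ : NonZero o}} → (m + n) % o ≡ (m % o + n) % o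
[m+n]%o≡[m%o+n]%o m n o = begin
  (m + n) % o             ≡⟨ %-distribˡ-+ m n o ⟩
  (m % o + n % o) % o     ≡⟨ cong (λ r → (r + n % o) % o) (m%n%n≡m%n m o) ⟨
  (m % o % o + n % o) % o ≡⟨ %-distribˡ-+ (m % o) n o ⟨
  (m % o + n) % o         ∎
  where open ≡-Reasoning

[m+n]%o≡m%o⇒o∣n : ∀ m n o .{{_ : NonZero o}} → (m + n) % o ≡ m % o → o ∣ℕ n
[m+n]%o≡m%o⇒o∣n m n o eq = divides ((r + n) / o) (ℕ.+-cancelˡ-≡ r n _ (begin
  r + n                         ≡⟨ m≡m%n+[m/n]*n (r + n) o ⟩
  (r + n) % o + (r + n) / o * o ≡⟨ cong (_+ (r + n) / o * o) r+n%o≡r ⟩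
  r + (r + n) / o * o           ∎))
  where
  open ≡-Reasoning
  r = m % o
  r+n%o≡r : (r + n) % o ≡ r
  r+n%o≡r = trans (sym ([m+n]%o≡[m%o+n]%o m n o)) eq

residue-reachable : ∀ {L} .{{_ : NonZero L}} {r k} → r < L → k < L → ∃ λ d → d < L × (r + d) % L ≡ k
residue-reachable {L} {r} {k} r<L k<L with ℕ.≤-<-connex r k
... | inj₁ r≤k = k ∸ r , ℕ.≤-<-trans (ℕ.m∸n≤m k r) k<L , (begin
  (r + (k ∸ r)) % L ≡⟨ cong (_% L) (ℕ.m+[n∸m]≡n r≤k) ⟩
  k % L             ≡⟨ m<n⇒m%n≡m k<L ⟩
  k                 ∎)
  where open ≡-Reasoning
... | inj₂ k<r = k + L ∸ r , ℕ.m<n+o⇒m∸n<o _ r (ℕ.+-monoˡ-< L k<r) , (begin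
  (r + (k + L ∸ r)) % L ≡⟨ cong (_% L) (ℕ.m+[n∸m]≡n (ℕ.≤-trans (ℕ.<⇒≤ r<L) (ℕ.m≤n+m L k))) ⟩
  (k + L) % L           ≡⟨ [m+n]%n≡m%n k L ⟩
  k % L                 ≡⟨ m<n⇒m%n≡m k<L ⟩
  k                     ∎)
  where open ≡-Reasoning

module _ {A : Set} (P Q : A → Set) (disjoint : ∀ {x} → P x → ¬ Q x) (g : ℕ → A) where

  discrete-ivt : ∀ {i} j → i ≤ j → (∀ k → i ≤ k → k ≤ j → P (g k) ⊎ Q (g k)) →
                 P (g i) → Q (g j) → ∃ λ k → P (g k) × Q (g (suc k))
  discrete-ivt zero z≤n _ p q = contradiction q (disjoint p)
  discrete-ivt (suc j) i≤1+j side p q with ℕ.m≤n⇒m<n∨m≡n i≤1+j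
  ... | inj₂ refl = contradiction q (disjoint p)
  ... | inj₁ (s≤s i≤j) with side j i≤j (ℕ.n≤1+n j)
  ...   | inj₁ pj = j , pj , q
  ...   | inj₂ qj = discrete-ivt j i≤j (λ k i≤k k≤j → side k i≤k (ℕ.m≤n⇒m≤1+n k≤j)) p qj

module _ {n} {f : Fin n → Fin n} (f-injective : ∀ {x y} → f x ≡ f y → x ≡ y) where

  fold-injective : ∀ i {x y} → fold x f i ≡ fold y f i → x ≡ y
  fold-injective zero eq = eq
  fold-injective (suc i) eq = fold-injective i (f-injective eq)

  fold-return : ∀ x i d → fold x f (i + d) ≡ fold x f i → fold x f d ≡ x
  fold-return x i d eq = fold-injective i (trans (sym (fold-+ x f i)) eq)

  fold-returns : ∀ x → ∃ λ d → d < n × fold x f (suc d) ≡ x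
  fold-returns x with pigeonhole (ℕ.n<1+n n) (λ (i : Fin (suc n)) → fold x f (toℕ i))
  ... | i , j , i<j , eq with <⇒∃-offset i<j
  ...   | d , i+1+d≡j = d , d<n , fold-return x (toℕ i) (suc d) (begin
    fold x f (toℕ i + suc d) ≡⟨ cong (fold x f) (trans (ℕ.+-suc (toℕ i) d) i+1+d≡j) ⟩
    fold x f (toℕ j)         ≡⟨ eq ⟨
    fold x f (toℕ i)         ∎)
    where
    open ≡-Reasoning
    d<n : d < n
    d<n = ℕ.m+n≤o⇒n≤o (toℕ i) (subst (_≤ n) (sym (ℕ.+-suc (toℕ i) d))
            (ℕ.≤-pred (subst (_< suc n) (sym i+1+d≡j) (toℕ<n j))))

  minimal-period : ∀ x → ∃ λ p → fold x f (suc p) ≡ x × (∀ d → d < p → fold x f (suc d) ≢ x)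
  minimal-period x with ¬∀⟶∃¬-smallest n NotReturned (λ i → ¬? (fold x f (suc (toℕ i)) Fin.≟ x)) returns
    where
    NotReturned : Fin n → Set
    NotReturned i = fold x f (suc (toℕ i)) ≢ x
    returns : ¬ (∀ i → NotReturned i)
    returns never with fold-returns x
    ... | d , d<n , ret = never (fromℕ< d<n) (subst (λ k → fold x f (suc k) ≡ x) (sym (toℕ-fromℕ< d<n)) ret)
  ... | i , returned , earlier = toℕ i , decidable-stable (_ Fin.≟ x) returned , not-earlier
    where
    not-earlier : ∀ d → d < toℕ i → fold x f (suc d) ≢ x
    not-earlier d d<i = subst (λ k → fold x f (suc k) ≢ x)
      (trans (toℕ-inject (fromℕ< d<i)) (toℕ-fromℕ< d<i)) (earlier (fromℕ< d<i))

  fold-≢-within-period : ∀ {x p} → (∀ d → d < p → fold x f (suc d) ≢ x) →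
                         ∀ {i j} → i < j → j ≤ p → fold x f i ≢ fold x f j
  fold-≢-within-period {x} {p} minimal {i} i<j j≤p eq with <⇒∃-offset i<j
  ... | d , refl = minimal d (ℕ.m+n≤o⇒n≤o i (subst (_≤ p) (sym (ℕ.+-suc i d)) j≤p))
    (fold-return x i (suc d) (trans (cong (fold x f) (ℕ.+-suc i d)) (sym eq)))

  fold-injective-within-period : ∀ {x p} → (∀ d → d < p → fold x f (suc d) ≢ x) →
                                 ∀ {i j} → i ≤ p → j ≤ p → fold x f i ≡ fold x f j → i ≡ j
  fold-injective-within-period minimal {i} {j} i≤p j≤p eq with ℕ.<-cmp i j
  ... | tri< i<j _ _ = contradiction eq (fold-≢-within-period minimal i<j j≤p)
  ... | tri≈ _ i≡j _ = i≡j
  ... | tri> _ _ j<i = contradiction (sym eq) (fold-≢-within-period minimal j<i i≤p)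

-- On Fin n, Between is definitionally BetweenCW.
open module FinCyclicOrder {n} = CyclicOrder (<-isStrictTotalOrder {n})

outerSucc-between : ∀ {n} {a b p : Fin n} → OuterSucc a b → p ≢ a → p ≢ b → Between a b p
outerSucc-between {a = a} {b} {p} (inj₁ 1+a≡b) p≢a p≢b with <-cmp p a
... | tri< p<a _ _ = inj₂ (p<a , inj₁ a<b)
  where
  a<b : a Fin.< b
  a<b = ℕ.≤-reflexive 1+a≡b
... | tri≈ _ p≡a _ = contradiction p≡a p≢a
... | tri> _ _ a<p = inj₁ (a<p , ℕ.≤-reflexive 1+a≡b , b<p)
  where
  b<p : b Fin.< p
  b<p = ℕ.≤∧≢⇒< (subst (_≤ toℕ p) 1+a≡b a<p) (p≢b ∘ sym ∘ toℕ-injective)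
outerSucc-between {a = a} {b} {p} (inj₂ (1+a≡n , b≡0)) p≢a p≢b = inj₂ (p<a , inj₂ b<p)
  where
  p<a : p Fin.< a
  p<a = ℕ.≤∧≢⇒< (ℕ.≤-pred (subst (toℕ p <_) (sym 1+a≡n) (toℕ<n p))) (p≢a ∘ toℕ-injective)
  b<p : b Fin.< p
  b<p = subst (_< toℕ p) (sym b≡0) (ℕ.n≢0⇒n>0 (p≢b ∘ toℕ-injective ∘ flip trans (sym b≡0)))

outerSucc-functional : ∀ {n} {a b b′ : Fin n} → OuterSucc a b → OuterSucc a b′ → b ≡ b′
outerSucc-functional (inj₁ e) (inj₁ e′) = toℕ-injective (trans (sym e) e′)
outerSucc-functional {b = b} (inj₁ e) (inj₂ (e′ , _)) =
  contradiction (subst (_< _) (trans (sym e) e′) (toℕ<n b)) (ℕ.<-irrefl refl)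
outerSucc-functional {b′ = b′} (inj₂ (e′ , _)) (inj₁ e) =
  contradiction (subst (_< _) (trans (sym e) e′) (toℕ<n b′)) (ℕ.<-irrefl refl)
outerSucc-functional (inj₂ (_ , e)) (inj₂ (_ , e′)) = toℕ-injective (trans e (sym e′))

outerSucc-injective : ∀ {n} {a a′ b : Fin n} → OuterSucc a b → OuterSucc a′ b → a ≡ a′
outerSucc-injective (inj₁ e) (inj₁ e′) = toℕ-injective (ℕ.suc-injective (trans e (sym e′)))
outerSucc-injective (inj₁ e) (inj₂ (_ , e′)) = contradiction (trans e e′) λ ()
outerSucc-injective (inj₂ (_ , e′)) (inj₁ e) = contradiction (trans e e′) λ ()
outerSucc-injective (inj₂ (e , _)) (inj₂ (e′ , _)) = toℕ-injective (ℕ.suc-injective (trans e (sym e′)))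

outerSucc-cycSuc : ∀ {m} (u : Fin (suc m)) → OuterSucc u (cycSuc u)
outerSucc-cycSuc {m} u = cases
  where
  cases : (suc (toℕ u) ≡ toℕ (cycSuc u)) ⊎ (suc (toℕ u) ≡ suc m × toℕ (cycSuc u) ≡ 0)
  cases with suc (toℕ u) ℕ.<? suc m
  ... | yes 1+u<n = inj₁ (sym (toℕ-fromℕ< 1+u<n))
  ... | no 1+u≮n = inj₂ (ℕ.≤-antisym (toℕ<n u) (ℕ.≮⇒≥ 1+u≮n) , refl)

toℕ-cycSuc : ∀ {m} (i : Fin (suc m)) → toℕ (cycSuc i) ≡ suc (toℕ i) % suc m
toℕ-cycSuc {m} i with outerSucc-cycSuc i
... | inj₁ 1+i≡i′ = trans (sym 1+i≡i′) (sym (m<n⇒m%n≡m (subst (_< suc m) (sym 1+i≡i′) (toℕ<n (cycSuc i)))))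
... | inj₂ (1+i≡n , i′≡0) = trans i′≡0 (sym (trans (cong (_% suc m) 1+i≡n) (n%n≡0 (suc m))))

cycPred : ∀ {m} → Fin (suc m) → Fin (suc m)
cycPred {m} Fin.zero = Fin.fromℕ m
cycPred (Fin.suc j) = Fin.inject₁ j

outerSucc-cycPred : ∀ {m} (u : Fin (suc m)) → OuterSucc (cycPred u) u
outerSucc-cycPred {m} Fin.zero = inj₂ (cong suc (toℕ-fromℕ m) , refl)
outerSucc-cycPred (Fin.suc j) = inj₁ (cong suc (toℕ-inject₁ j))

module Outerplane {m} (G : Outerplane2Conn (suc m)) (white : Fin (suc m) → Bool)
                  (proper : ProperColoring G white) where
  open Outerplane2Conn G

  private
    V : Set
    V = Fin (suc m)
    n : ℕ
    n = suc m

  edges-noncrossing : ∀ {c d s t} → Adj c d → Adj s t → Between c s d → Between d t c → ⊥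
  edges-noncrossing cd st (inj₁ (_ , c<s , s<d)) (inj₂ (_ , inj₁ d<t)) = noncross cd st (c<s , s<d , d<t)
  edges-noncrossing cd st (inj₁ (_ , c<s , s<d)) (inj₂ (_ , inj₂ t<c)) = noncross (adj-sym st) cd (t<c , c<s , s<d)
  edges-noncrossing cd st (inj₁ (c<d , _)) (inj₁ (d<c , _)) = <-asym c<d d<c
  edges-noncrossing cd st (inj₂ (d<c , _)) (inj₂ (c<d , _)) = <-asym c<d d<c
  edges-noncrossing cd st (inj₂ (_ , inj₁ c<s)) (inj₁ (_ , d<t , t<c)) =
    noncross (adj-sym cd) (adj-sym st) (d<t , t<c , c<s)
  edges-noncrossing cd st (inj₂ (_ , inj₂ s<d)) (inj₁ (_ , d<t , t<c)) = noncross st (adj-sym cd) (s<d , d<t , t<c)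

  consecutive-not-outer-reversed : ∀ {S} a b → 3 ≤ ∣ S ∣ → Consecutive G white S a b → ¬ OuterSucc b a
  consecutive-not-outer-reversed a b 3≤∣S∣ (_ , _ , _ , nothing-between) b→a with ∃-∉⁅x,y⁆ 3≤∣S∣ a b
  ... | z , z∈S , z≢a , z≢b = nothing-between z z∈S (between-rotate (outerSucc-between b→a z≢b z≢a))

  closest-after : ∀ S u {c} → c ∈ S → c ≢ u → (xs : List V) →
    ∃ λ v → v ∈ S × v ≢ u × (∀ {w} → Between u w v → Between u w c)
          × All (λ w → w ∈ S → ¬ Between u w v) xs
  closest-after S u c∈S c≢u [] = _ , c∈S , c≢u , id , []
  closest-after S u {c} c∈S c≢u (x ∷ xs) with x ∈? S ×-dec between? u x c
  ... | yes (x∈S , uxc) =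
    let v , v∈S , v≢u , closer , rest = closest-after S u x∈S (between⇒≢ˡ uxc ∘ sym) xs
    in v , v∈S , v≢u , (λ uwv → between-trans (closer uwv) uxc) , (λ _ uxv → between⇒≢ʳ (closer uxv) refl) ∷ rest
  ... | no ¬x∈S×uxc =
    let v , v∈S , v≢u , closer , rest = closest-after S u c∈S c≢u xs
    in v , v∈S , v≢u , closer , (λ x∈S uxv → ¬x∈S×uxc (x∈S , closer uxv)) ∷ rest

  consecutive-exists : ∀ {S u} → 3 ≤ ∣ S ∣ → u ∈ S → ∃ λ v → Consecutive G white S u v
  consecutive-exists {S} {u} 3≤∣S∣ u∈S with ∃-∉⁅x,y⁆ 3≤∣S∣ u u
  ... | c , c∈S , c≢u , _ with closest-after S u c∈S c≢u (allFin n)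
  ...   | v , v∈S , v≢u , _ , none-between =
    v , u∈S , v∈S , v≢u ∘ sym , λ w w∈S → All.lookup none-between (∈-allFin w) w∈S

  adjacent-colour : ∀ {u v} → Adj u v → white u ≡ not (white v)
  adjacent-colour uv = ¬-not (proper uv)

  partner-injective : ∀ (M : PerfectMatching G) {x y} → partner M x ≡ partner M y → x ≡ y
  partner-injective M {x} {y} eq = trans (sym (partner-invol M x)) (trans (cong (partner M) eq) (partner-invol M y))

  partner-colour : ∀ (M : PerfectMatching G) v → white (partner M v) ≡ not (white v)
  partner-colour M v = adjacent-colour (adj-sym (partner-adj M v))

  partners-same-colour : ∀ (P Q : PerfectMatching G) {x y} → partner P x ≡ partner Q y → white x ≡ white y
  partners-same-colour P Q {x} {y} eq =
    not-injective (trans (sym (partner-colour P x)) (trans (cong white eq) (partner-colour Q y)))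

  Moved : PerfectMatching G → PerfectMatching G → V → Set
  Moved M₀ N u = partner N u ≢ partner M₀ u

  InUnion : PerfectMatching G → PerfectMatching G → V → V → Set
  InUnion M₀ N u y = partner N u ≡ y ⊎ partner M₀ u ≡ y

  partner-≢ : ∀ (M : PerfectMatching G) u → partner M u ≢ u
  partner-≢ M u Mu≡u = adj-irrefl (subst (Adj u) Mu≡u (partner-adj M u))

  symDiff-adj : ∀ {M M′ a b} → SymDiff G white M M′ a b → Adj a b
  symDiff-adj {M} (inj₁ (Ma≡b , _)) = subst (Adj _) Ma≡b (partner-adj M _)
  symDiff-adj {M′ = M′} (inj₂ (_ , M′a≡b)) = subst (Adj _) M′a≡b (partner-adj M′ _)

  BlackToWhiteOuter : PerfectMatching G → Set
  BlackToWhiteOuter M = ∀ v → white v ≡ false → OuterSucc v (partner M v)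

  blackToWhite-white : ∀ {M} → BlackToWhiteOuter M → ∀ v → white v ≡ true → OuterSucc (partner M v) v
  blackToWhite-white {M} outerM v wv = subst (OuterSucc (partner M v)) (partner-invol M v)
    (outerM (partner M v) (trans (partner-colour M v) (cong not wv)))

  outerPartner : V → V
  outerPartner v with white v
  ... | true = cycPred v
  ... | false = cycSuc v

  outerPartner-adj : ∀ v → Adj v (outerPartner v)
  outerPartner-adj v with white v
  ... | true = adj-sym (outer _ _ (outerSucc-cycPred v))
  ... | false = outer _ _ (outerSucc-cycSuc v)

  outerPartner-invol : ∀ v → outerPartner (outerPartner v) ≡ v
  outerPartner-invol v with white v in wv
  ... | true with white (cycPred v) in wp
  ...   | false = outerSucc-functional (outerSucc-cycSuc (cycPred v)) (outerSucc-cycPred v)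
  ...   | true = contradiction (trans wp (sym wv)) (proper (outer _ _ (outerSucc-cycPred v)))
  outerPartner-invol v | false with white (cycSuc v) in ws
  ...   | true = outerSucc-injective (outerSucc-cycPred (cycSuc v)) (outerSucc-cycSuc v)
  ...   | false = contradiction (trans wv (sym ws)) (proper (outer _ _ (outerSucc-cycSuc v)))

  outerMatching : PerfectMatching G
  outerMatching = record
    { partner = outerPartner ; partner-adj = outerPartner-adj ; partner-invol = outerPartner-invol }

  outerMatching-blackToWhite : BlackToWhiteOuter outerMatching
  outerMatching-blackToWhite v bv with white v
  ... | false = outerSucc-cycSuc v

  blackToWhite-no-proper-face-edge : ∀ {M f} → BlackToWhiteOuter M → 3 ≤ ∣ f ∣ →
    ∀ u v → Consecutive G white f u v → partner M u ≡ v → white u ≡ true → ⊥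
  blackToWhite-no-proper-face-edge {M} outerM 3≤∣f∣ u v uv Mu≡v wu =
    consecutive-not-outer-reversed u v 3≤∣f∣ uv (subst (λ x → OuterSucc x u) Mu≡v (blackToWhite-white {M} outerM u wu))

  blackToWhite-sink : ∀ {M N} → BlackToWhiteOuter M → ¬ ZArc G white M N
  blackToWhite-sink {M} outerM (f , (3≤∣f∣ , _) , _ , alternating , properly-oriented)
    with ∃-∉⁅x,y⁆ 3≤∣f∣ Fin.zero Fin.zero
  ... | u , u∈f , _ with consecutive-exists 3≤∣f∣ u∈f
  ... | v , uv with consecutive-exists 3≤∣f∣ (proj₁ (proj₂ uv))
  ... | w , vw with alternating u v w uv vw
  ... | inj₁ (Mu≡v , _) =
    blackToWhite-no-proper-face-edge {M} outerM 3≤∣f∣ u v uv Mu≡v (properly-oriented u v uv Mu≡v)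
  ... | inj₂ (_ , Mv≡w) =
    blackToWhite-no-proper-face-edge {M} outerM 3≤∣f∣ v w vw Mv≡w (properly-oriented v w vw Mv≡w)

  least-blackToWhite : ∀ {M₀} → IsLeast G white M₀ → BlackToWhiteOuter M₀
  least-blackToWhite least with least outerMatching
  ... | ε = outerMatching-blackToWhite
  ... | _◅_ {j = N} arc _ = ⊥-elim (blackToWhite-sink {outerMatching} {N} outerMatching-blackToWhite arc)

  walk-crossing-forward : (g : ℕ → V) → (∀ j → Adj (g j) (g (suc j))) → ∀ {c d i₁ i₂} →
    (∀ k → i₁ ≤ k → k ≤ i₂ → g k ≢ c × g k ≢ d) → i₁ ≤ i₂ →
    Between c (g i₁) d → Between d (g i₂) c →
    ∃ λ s → ∃ λ t → Adj s t × Between c s d × Between d t c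
  walk-crossing-forward g steps {c} {d} {i₁} {i₂} avoids i₁≤i₂ ci₁d di₂c
    with discrete-ivt (λ x → Between c x d) (λ x → Between d x c) between-asym g i₂ i₁≤i₂ side ci₁d di₂c
    where
    side : ∀ k → i₁ ≤ k → k ≤ i₂ → Between c (g k) d ⊎ Between d (g k) c
    side k i₁≤k k≤i₂ = let ≢c , ≢d = avoids k i₁≤k k≤i₂ in between-total (between⇒≢ ci₁d) ≢c ≢d
  ... | k , ckd , dk′c = g k , g (suc k) , steps k , ckd , dk′c

  walk-crossing : (g : ℕ → V) → (∀ j → Adj (g j) (g (suc j))) → ∀ {c d lo hi} →
    (∀ k → lo ≤ k → k < hi → g k ≢ c × g k ≢ d) →
    ∀ {i₁ i₂} → lo ≤ i₁ → i₁ < hi → lo ≤ i₂ → i₂ < hi →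
    Between c (g i₁) d → Between d (g i₂) c →
    ∃ λ s → ∃ λ t → Adj s t × Between c s d × Between d t c
  walk-crossing g steps avoids {i₁} {i₂} lo≤i₁ i₁<hi lo≤i₂ i₂<hi ci₁d di₂c with ℕ.≤-total i₁ i₂
  ... | inj₁ i₁≤i₂ = walk-crossing-forward g steps
    (λ k i₁≤k k≤i₂ → avoids k (ℕ.≤-trans lo≤i₁ i₁≤k) (ℕ.≤-<-trans k≤i₂ i₂<hi))
    i₁≤i₂ ci₁d di₂c
  ... | inj₂ i₂≤i₁ with walk-crossing-forward g steps
    (λ k i₂≤k k≤i₁ → swap (avoids k (ℕ.≤-trans lo≤i₂ i₂≤k) (ℕ.≤-<-trans k≤i₁ i₁<hi)))
    i₂≤i₁ di₂c ci₁d
  ...   | s , t , st , dsc , ctd = t , s , adj-sym st , ctd , dsc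

  face-not-separated : ∀ {g z a s t} → IsInnerFace G white g → z ∈ g → a ∈ g →
                       Adj s t → Between z s a → Between a t z → ⊥
  face-not-separated {s = s} {t} (_ , _ , unseparated) z∈g a∈g st zsa atz =
    let tzs , sat = between-interleave zsa atz
    in unseparated t s (adj-sym st) (_ , _ , z∈g , a∈g , tzs , sat)

  module OnSymDiffCycle {M₀ N : PerfectMatching G} (C : SymDiffCycle G white M₀ N) where
    open SymDiffCycle C

    L : ℕ
    L = suc (suc (suc len))

    walk : ℕ → V
    walk j = vtx (j mod L)

    OnC : V → Set
    OnC = OnCycle G white C

    onC? : ∀ x → Dec (OnC x)
    onC? x = any? (λ i → vtx i Fin.≟ x)

    mod-suc : ∀ j → suc j mod L ≡ cycSuc (j mod L)
    mod-suc j = toℕ-injective (begin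
      toℕ (suc j mod L)          ≡⟨ toℕ-fromℕ< _ ⟩
      suc j % L                  ≡⟨ cong (_% L) (ℕ.+-comm 1 j) ⟩
      (j + 1) % L                ≡⟨ [m+n]%o≡[m%o+n]%o j 1 L ⟩
      (j % L + 1) % L            ≡⟨ cong (_% L) (ℕ.+-comm (j % L) 1) ⟩
      suc (j % L) % L            ≡⟨ cong (λ r → suc r % L) (toℕ-fromℕ< (m%n<n j L)) ⟨
      suc (toℕ (j mod L)) % L    ≡⟨ toℕ-cycSuc (j mod L) ⟨
      toℕ (cycSuc (j mod L))     ∎)
      where open ≡-Reasoning

    walk-edge : ∀ j → SymDiff G white N M₀ (walk j) (walk (suc j))
    walk-edge j = subst (SymDiff G white N M₀ (walk j) ∘ vtx) (sym (mod-suc j)) (edges (j mod L))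

    walk-adj : ∀ j → Adj (walk j) (walk (suc j))
    walk-adj j = symDiff-adj {N} {M₀} (walk-edge j)

    walk-on : ∀ j → OnC (walk j)
    walk-on j = j mod L , refl

    walk-injective-window : ∀ {j k} → j < k → k < j + L → walk k ≢ walk j
    walk-injective-window {j} j<k k<j+L walk-k≡walk-j with <⇒∃-offset j<k
    ... | d , refl = ℕ.<⇒≱ 1+d<L (∣⇒≤ ([m+n]%o≡m%o⇒o∣n j (suc d) L (begin
      (j + suc d) % L         ≡⟨ cong (_% L) (ℕ.+-suc j d) ⟩
      suc (j + d) % L         ≡⟨ toℕ-fromℕ< _ ⟨
      toℕ ((suc j + d) mod L) ≡⟨ cong toℕ (inj _ _ walk-k≡walk-j) ⟩
      toℕ (j mod L)           ≡⟨ toℕ-fromℕ< _ ⟩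
      j % L                   ∎)))
      where
      open ≡-Reasoning
      1+d<L : suc d < L
      1+d<L = ℕ.+-cancelˡ-< j _ _ (subst (_< j + L) (sym (ℕ.+-suc j d)) k<j+L)

    walk-surjective-window : ∀ j {x} → OnC x → ∃ λ k → j ≤ k × k < j + L × walk k ≡ x
    walk-surjective-window j (i , vtx-i≡x) with residue-reachable (m%n<n j L) (toℕ<n i)
    ... | d , d<L , j%L+d≡i = j + d , ℕ.m≤m+n j d , ℕ.+-monoʳ-< j d<L , trans (cong vtx mod≡i) vtx-i≡x
      where
      mod≡i : (j + d) mod L ≡ i
      mod≡i = toℕ-injective (trans (toℕ-fromℕ< _) (trans ([m+n]%o≡[m%o+n]%o j d L) j%L+d≡i))

    walk-moved : ∀ j → Moved M₀ N (walk j)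
    walk-moved j Nw≡M₀w with walk-edge j
    ... | inj₁ (Nw≡w′ , M₀w≢w′) = M₀w≢w′ (trans (sym Nw≡M₀w) Nw≡w′)
    ... | inj₂ (Nw≢w′ , M₀w≡w′) = Nw≢w′ (trans Nw≡M₀w M₀w≡w′)

    walk-index-beyond : ∀ {j k} → j ≤ k → walk k ≢ walk j → j < k
    walk-index-beyond j≤k walk-k≢walk-j = ℕ.≤∧≢⇒< j≤k (walk-k≢walk-j ∘ cong walk ∘ sym)

    on⇒walk : ∀ {u} → OnC u → ∃ λ j → walk (suc j) ≡ u
    on⇒walk ou with walk-surjective-window 1 ou
    ... | suc j , _ , _ , walk-1+j≡u = j , walk-1+j≡u

    on-moved : ∀ {u} → OnC u → Moved M₀ N u
    on-moved ou with on⇒walk ou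
    ... | j , refl = walk-moved (suc j)

    walk-neighbours : ∀ j {y} → InUnion M₀ N (walk (suc j)) y → y ≡ walk j ⊎ y ≡ walk (suc (suc j))
    walk-neighbours j = pair-exhausted previous next distinct
      where
      previous : InUnion M₀ N (walk (suc j)) (walk j)
      previous with Xor⇒⊎ (walk-edge j)
      ... | inj₁ N-edge = inj₁ (trans (cong (partner N) (sym N-edge)) (partner-invol N _))
      ... | inj₂ M₀-edge = inj₂ (trans (cong (partner M₀) (sym M₀-edge)) (partner-invol M₀ _))
      next : InUnion M₀ N (walk (suc j)) (walk (suc (suc j)))
      next = Xor⇒⊎ (walk-edge (suc j))
      distinct : walk j ≢ walk (suc (suc j))
      distinct = walk-injective-window (s≤s (ℕ.n≤1+n j))
        (subst (_< j + L) (ℕ.+-comm j 2) (ℕ.+-monoʳ-< j (s≤s (s≤s (s≤s z≤n))))) ∘ sym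

    on-inUnion : ∀ {u y} → OnC u → InUnion M₀ N u y → OnC y
    on-inUnion ou uy with on⇒walk ou
    ... | j , refl with walk-neighbours j uy
    ...   | inj₁ refl = walk-on j
    ...   | inj₂ refl = walk-on (suc (suc j))

    -- The rest of the cycle is a walk from p to q avoiding both ends of the edge.
    walk-edge-uncrossed : ∀ j {p q} → OnC p → OnC q →
                          Between (walk j) p (walk (suc j)) → ¬ Between (walk (suc j)) q (walk j)
    walk-edge-uncrossed j op oq jp1 1qj with walk-surjective-window j op | walk-surjective-window j oq
    ... | k₁ , j≤k₁ , k₁<hi , refl | k₂ , j≤k₂ , k₂<hi , refl =
      let _ , _ , st , jsj′ , j′tj = walk-crossing walk walk-adj avoids
            (beyond j≤k₁ (between⇒≢ˡ jp1 ∘ sym) (between⇒≢ʳ jp1)) k₁<hi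
            (beyond j≤k₂ (between⇒≢ʳ 1qj) (between⇒≢ˡ 1qj ∘ sym)) k₂<hi jp1 1qj
      in edges-noncrossing (walk-adj j) st jsj′ j′tj
      where
      beyond : ∀ {k} → j ≤ k → walk k ≢ walk j → walk k ≢ walk (suc j) → suc j < k
      beyond j≤k ≢j ≢j′ = walk-index-beyond (walk-index-beyond j≤k ≢j) ≢j′
      avoids : ∀ k → suc (suc j) ≤ k → k < j + L → walk k ≢ walk j × walk k ≢ walk (suc j)
      avoids k 2+j≤k k<hi = walk-injective-window (ℕ.<-trans (ℕ.n<1+n j) 2+j≤k) k<hi
                          , walk-injective-window 2+j≤k (ℕ.m<n⇒m<1+n k<hi)

    inUnion-edge-uncrossed : ∀ {a b p q} → OnC a → InUnion M₀ N a b → OnC p → OnC q →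
                             Between a p b → ¬ Between b q a
    inUnion-edge-uncrossed oa ab op oq apb bqa with on⇒walk oa
    ... | j , refl with walk-neighbours j ab
    ...   | inj₁ refl = walk-edge-uncrossed j oq op bqa apb
    ...   | inj₂ refl = walk-edge-uncrossed (suc j) op oq apb bqa

    off-cycle-separated : ∀ {z a p q} → ¬ OnC z → OnC a → OnC p → OnC q → Between z p a → Between a q z →
                          ∃ λ s → ∃ λ t → Adj s t × Between z s a × Between a t z
    off-cycle-separated nz oa op oq zpa aqz with on⇒walk oa
    ... | j , refl with walk-surjective-window (suc j) op | walk-surjective-window (suc j) oq
    ... | k₁ , ≤k₁ , k₁<hi , refl | k₂ , ≤k₂ , k₂<hi , refl =
      walk-crossing walk walk-adj avoids (walk-index-beyond ≤k₁ (between⇒≢ʳ zpa)) k₁<hi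
        (walk-index-beyond ≤k₂ (between⇒≢ˡ aqz ∘ sym)) k₂<hi zpa aqz
      where
      avoids : ∀ k → suc (suc j) ≤ k → k < suc j + L → walk k ≢ _ × walk k ≢ walk (suc j)
      avoids k lo≤k k<hi = (λ walk-k≡z → nz (subst OnC walk-k≡z (walk-on k))) , walk-injective-window lo≤k k<hi

    face-vertex-on-cycle : ∀ {g a b y z} → IsInnerFace G white g → a ∈ g → b ∈ g → OnC a → OnC b →
                           OnC y → Between a y b → z ∈ g → Between a z b → OnC z
    face-vertex-on-cycle {z = z} face a∈g b∈g oa ob oy ayb z∈g azb with onC? z
    ... | yes oz = oz
    ... | no nz with between-split azb ayb (λ y≡z → nz (subst OnC y≡z oy))
    ...   | inj₁ ayz = let _ , _ , st , zsa , atz = off-cycle-separated nz oa ob oy (between-rotate azb) ayz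
                       in ⊥-elim (face-not-separated face z∈g a∈g st zsa atz)
    ...   | inj₂ zyb = let _ , _ , st , zsb , btz = off-cycle-separated nz ob oy oa zyb (between-rotate² azb)
                       in ⊥-elim (face-not-separated face z∈g b∈g st zsb btz)

    face-within-cycle : ∀ {g a b y} → IsInnerFace G white g → Consecutive G white g a b →
                        OnC a → OnC b → OnC y → Between b y a → ∀ z → z ∈ g → OnC z
    face-within-cycle {a = a} {b} face (a∈g , b∈g , a≢b , nothing-between) oa ob oy bya z z∈g with z Fin.≟ a | z Fin.≟ b
    ... | yes refl | _ = oa
    ... | no _ | yes refl = ob
    ... | no z≢a | no z≢b with between-total (a≢b ∘ sym) z≢b z≢a
    ...   | inj₁ bza = face-vertex-on-cycle face b∈g a∈g ob oa oy bya z∈g bza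
    ...   | inj₂ azb = ⊥-elim (nothing-between z z∈g azb)

    -- M₀ u is the boundary neighbour of u, on the far side of the cycle edge from u to N u.
    white-edge-side : BlackToWhiteOuter M₀ → ∀ {u p} → OnC u → white u ≡ true → OnC p →
                      ¬ Between u p (partner N u)
    white-edge-side outerM₀ {u} ou wu op upx =
      inUnion-edge-uncrossed ou (inj₁ refl) op (on-inUnion ou (inj₂ refl)) upx
        (between-rotate² (outerSucc-between (blackToWhite-white {M₀} outerM₀ u wu) (on-moved ou) (partner-≢ N u)))

    black-edge-side : BlackToWhiteOuter M₀ → ∀ {u p} → OnC u → white u ≡ false → OnC p →
                      ¬ Between (partner N u) p u
    black-edge-side outerM₀ {u} ou bu op xpu =
      inUnion-edge-uncrossed (on-inUnion ou (inj₁ refl)) (inj₁ (partner-invol N u)) op (on-inUnion ou (inj₂ refl)) xpu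
        (outerSucc-between (outerM₀ u bu) (partner-≢ N u) (on-moved ou))

  module AlternatingOrbit (M₀ N : PerfectMatching G) where

    alternate : V → V
    alternate x with white x
    ... | true = partner N x
    ... | false = partner M₀ x

    alternate-white : ∀ {x} → white x ≡ true → alternate x ≡ partner N x
    alternate-white {x} wx with white x
    alternate-white refl | true = refl

    alternate-black : ∀ {x} → white x ≡ false → alternate x ≡ partner M₀ x
    alternate-black {x} bx with white x
    alternate-black refl | false = refl

    alternate-injective : ∀ {x y} → alternate x ≡ alternate y → x ≡ y
    alternate-injective {x} {y} eq with white x in wx | white y in wy
    ... | true | true = partner-injective N eq
    ... | false | false = partner-injective M₀ eq
    ... | true | false = contradiction (trans (sym wx) (trans (partners-same-colour N M₀ eq) wy)) λ ()
    ... | false | true = contradiction (trans (sym wx) (trans (partners-same-colour M₀ N eq) wy)) λ ()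

    alternate-≢ : ∀ x → alternate x ≢ x
    alternate-≢ x with white x
    ... | true = partner-≢ N x
    ... | false = partner-≢ M₀ x

    alternate-symDiff : ∀ {x} → Moved M₀ N x → SymDiff G white N M₀ x (alternate x)
    alternate-symDiff {x} moved with white x
    ... | true = inj₁ (refl , moved ∘ sym)
    ... | false = inj₂ (moved , refl)

    alternate-moved : ∀ {x} → Moved M₀ N x → Moved M₀ N (alternate x)
    alternate-moved {x} moved with white x
    ... | true = λ N²x≡M₀Nx → moved (sym (begin
      partner M₀ x                         ≡⟨ cong (partner M₀) (trans (sym (partner-invol N x)) N²x≡M₀Nx) ⟩
      partner M₀ (partner M₀ (partner N x)) ≡⟨ partner-invol M₀ _ ⟩
      partner N x                          ∎))
      where open ≡-Reasoning
    ... | false = λ NM₀x≡M₀²x → moved (begin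
      partner N x                          ≡⟨ cong (partner N) (trans NM₀x≡M₀²x (partner-invol M₀ x)) ⟨
      partner N (partner N (partner M₀ x)) ≡⟨ partner-invol N _ ⟩
      partner M₀ x                         ∎)
      where open ≡-Reasoning

    alternate²-≢ : ∀ {x} → Moved M₀ N x → alternate (alternate x) ≢ x
    alternate²-≢ {x} moved alt²x≡x with white x in wx
    ... | true = moved (partner-injective M₀ (begin
      partner M₀ (partner N x)  ≡⟨ alternate-black (trans (partner-colour N x) (cong not wx)) ⟨
      alternate (partner N x)   ≡⟨ alt²x≡x ⟩
      x                         ≡⟨ partner-invol M₀ x ⟨
      partner M₀ (partner M₀ x) ∎))
      where open ≡-Reasoning
    ... | false = moved (partner-injective N (begin
      partner N (partner N x)   ≡⟨ partner-invol N x ⟩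
      x                         ≡⟨ alt²x≡x ⟨
      alternate (partner M₀ x)  ≡⟨ alternate-white (trans (partner-colour M₀ x) (cong not wx)) ⟩
      partner N (partner M₀ x)  ∎))
      where open ≡-Reasoning

    orbit-moved : ∀ {a} → Moved M₀ N a → ∀ k → Moved M₀ N (fold a alternate k)
    orbit-moved moved zero = moved
    orbit-moved moved (suc k) = alternate-moved (orbit-moved moved k)

    orbit-cycle : ∀ {a} → Moved M₀ N a → ∀ len → fold a alternate (suc (suc (suc len))) ≡ a →
                  (∀ d → d < suc (suc len) → fold a alternate (suc d) ≢ a) → SymDiffCycle G white M₀ N
    orbit-cycle {a} moved len returns minimal = record { len = len ; vtx = vtx ; inj = inj ; edges = edges }
      where
      vtx : Fin (suc (suc (suc len))) → V
      vtx i = fold a alternate (toℕ i)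
      inj : ∀ i j → vtx i ≡ vtx j → i ≡ j
      inj i j eq = toℕ-injective (fold-injective-within-period alternate-injective minimal
                     (ℕ.≤-pred (toℕ<n i)) (ℕ.≤-pred (toℕ<n j)) eq)
      alternate-vtx : ∀ i → alternate (vtx i) ≡ vtx (cycSuc i)
      alternate-vtx i with outerSucc-cycSuc i
      ... | inj₁ 1+i≡i′ = cong (fold a alternate) 1+i≡i′
      ... | inj₂ (1+i≡L , i′≡0) =
        trans (cong (fold a alternate) 1+i≡L) (trans returns (cong (fold a alternate) (sym i′≡0)))
      edges : ∀ i → SymDiff G white N M₀ (vtx i) (vtx (cycSuc i))
      edges i = subst (SymDiff G white N M₀ (vtx i)) (alternate-vtx i) (alternate-symDiff (orbit-moved moved (toℕ i)))

    cycle-through : ∀ {a} → Moved M₀ N a → Σ (SymDiffCycle G white M₀ N) λ C → OnCycle G white C a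
    cycle-through {a} moved = from-period (minimal-period alternate-injective a)
      where
      from-period : (∃ λ p → fold a alternate (suc p) ≡ a × (∀ d → d < p → fold a alternate (suc d) ≢ a)) →
                    Σ (SymDiffCycle G white M₀ N) λ C → OnCycle G white C a
      from-period (zero , returns , _) = contradiction returns (alternate-≢ a)
      from-period (suc zero , returns , _) = contradiction returns (alternate²-≢ moved)
      from-period (suc (suc len) , returns , minimal) = orbit-cycle moved len returns minimal , Fin.zero , refl

  WhiteToBlackEdge : Subset n → V → V → Set
  WhiteToBlackEdge h a b = Consecutive G white h a b × white a ≡ true

  flipping-face : ∀ {M₀ N u x} → Star (ZArc G white) N M₀ → partner N u ≡ x → partner M₀ u ≢ x →
                  ∃ λ h → IsInnerFace G white h × (WhiteToBlackEdge h u x ⊎ WhiteToBlackEdge h x u)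
  flipping-face ε Nu≡x M₀u≢x = contradiction Nu≡x M₀u≢x
  flipping-face {N = N} {u} {x} (_◅_ {j = N₁} (h , face , boundary , _ , proper-edges) path) Nu≡x M₀u≢x
    with partner N₁ u Fin.≟ x
  ... | yes N₁u≡x = flipping-face path N₁u≡x M₀u≢x
  ... | no N₁u≢x with Equivalence.to (boundary u x) (inj₁ (Nu≡x , N₁u≢x))
  ...   | inj₁ ux = h , face , inj₁ (ux , proper-edges u x ux Nu≡x)
  ...   | inj₂ xu = h , face , inj₂ (xu , proper-edges x u xu (trans (cong (partner N) (sym Nu≡x)) (partner-invol N u)))

  module _ {M₀ : PerfectMatching G} (outerM₀ : BlackToWhiteOuter M₀) where

    σ-dual-arc-closed : ∀ {N f g} → DualArc G white f g → σ G white M₀ N f → σ G white M₀ N g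
    σ-dual-arc-closed (_ , face-g , u , v , uv , fuv , gvu , wv) (_ , C , f⊆C) =
      face-g , C , face-within-cycle face-g gvu ov ou (on-inUnion ou (inj₂ refl)) u-M₀u-v
      where
      open OnSymDiffCycle C
      ou : OnC u
      ou = f⊆C u (proj₁ fuv)
      ov : OnC v
      ov = f⊆C v (proj₁ (proj₂ fuv))
      u→M₀u : OuterSucc u (partner M₀ u)
      u→M₀u = outerM₀ u (trans (adjacent-colour uv) (cong not wv))
      M₀u≢v : partner M₀ u ≢ v
      M₀u≢v M₀u≡v = consecutive-not-outer-reversed v u (proj₁ face-g) gvu (subst (OuterSucc u) M₀u≡v u→M₀u)
      u-M₀u-v : Between u (partner M₀ u) v
      u-M₀u-v = outerSucc-between u→M₀u (proj₁ (proj₂ (proj₂ fuv)) ∘ sym) (M₀u≢v ∘ sym)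

    σ-isOrderIdeal : ∀ N → IsOrderIdeal G white (σ G white M₀ N)
    σ-isOrderIdeal N = (λ _ → proj₁) , λ _ _ σf₂ f₁⪯f₂ → along f₁⪯f₂ σf₂
      where
      along : ∀ {f g} → Star (DualArc G white) f g → σ G white M₀ N f → σ G white M₀ N g
      along ε σf = σf
      along (arc ◅ arcs) σf = along arcs (σ-dual-arc-closed arc σf)

    face-inside-cycle : ∀ {N h a b} → IsInnerFace G white h → WhiteToBlackEdge h a b → partner N a ≡ b →
                        (C : SymDiffCycle G white M₀ N) → OnCycle G white C a → σ G white M₀ N h
    face-inside-cycle {a = a} face (ab , wa) Na≡b C oa =
      face , C , face-within-cycle face ab oa ob (on-inUnion oa (inj₂ refl)) b-M₀a-a
      where
      open OnSymDiffCycle C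
      ob : OnC _
      ob = on-inUnion oa (inj₁ Na≡b)
      b-M₀a-a : Between _ (partner M₀ a) a
      b-M₀a-a = between-rotate² (outerSucc-between (blackToWhite-white {M₀} outerM₀ a wa)
                  (on-moved oa ∘ trans Na≡b) (proj₁ (proj₂ (proj₂ ab)) ∘ sym))

    moved-face : ∀ {N u} → Star (ZArc G white) N M₀ → Moved M₀ N u →
                 ∃ λ h → σ G white M₀ N h × u ∈ h × partner N u ∈ h
    moved-face {N} {u} path moved = face-of (flipping-face path refl (moved ∘ sym))
      where
      open AlternatingOrbit M₀ N using (cycle-through)
      C = proj₁ (cycle-through moved)
      ou = proj₂ (cycle-through moved)
      face-of : ∃ (λ h → IsInnerFace G white h ×
                         (WhiteToBlackEdge h u (partner N u) ⊎ WhiteToBlackEdge h (partner N u) u)) →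
                ∃ λ h → σ G white M₀ N h × u ∈ h × partner N u ∈ h
      face-of (h , face , inj₁ ux@((u∈h , x∈h , _) , _)) = h , face-inside-cycle face ux refl C ou , u∈h , x∈h
      face-of (h , face , inj₂ xu@((x∈h , u∈h , _) , _)) =
        h , face-inside-cycle face xu (partner-invol N u) C (OnSymDiffCycle.on-inUnion C ou (inj₁ refl)) , u∈h , x∈h

    σ-moved : ∀ {N h u} → σ G white M₀ N h → u ∈ h → Moved M₀ N u
    σ-moved (_ , C , h⊆C) u∈h = OnSymDiffCycle.on-moved C (h⊆C _ u∈h)

    σ-⊆-preserves-moved : ∀ {N N′ u} → Star (ZArc G white) N M₀ →
                         (∀ S → σ G white M₀ N S → σ G white M₀ N′ S) → Moved M₀ N u → Moved M₀ N′ u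
    σ-⊆-preserves-moved path σ⊆ moved =
      let h , σh , u∈h , _ = moved-face path moved in σ-moved (σ⊆ h σh) u∈h

    partners-on-both-cycles : ∀ {N N′ u} (C : SymDiffCycle G white M₀ N) (C′ : SymDiffCycle G white M₀ N′) →
      OnCycle G white C u → OnCycle G white C (partner N′ u) →
      OnCycle G white C′ u → OnCycle G white C′ (partner N u) →
      partner N u ≢ partner N′ u → ⊥
    partners-on-both-cycles {N} {N′} {u} C C′ ou ox′ ou′ ox x≢x′
      with between-total (partner-≢ N u ∘ sym) (partner-≢ N′ u) (x≢x′ ∘ sym) | white u in wu
    ... | inj₁ u-x′-x | true = OnSymDiffCycle.white-edge-side C outerM₀ ou wu ox′ u-x′-x
    ... | inj₂ x-x′-u | true = OnSymDiffCycle.white-edge-side C′ outerM₀ ou′ wu ox (between-rotate² x-x′-u)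
    ... | inj₁ u-x′-x | false = OnSymDiffCycle.black-edge-side C′ outerM₀ ou′ wu ox (between-rotate u-x′-x)
    ... | inj₂ x-x′-u | false = OnSymDiffCycle.black-edge-side C outerM₀ ou wu ox′ x-x′-u

    σ-injective : ∀ {N N′} → Star (ZArc G white) N M₀ → Star (ZArc G white) N′ M₀ →
                  (∀ S → σ G white M₀ N S ⇔ σ G white M₀ N′ S) → ∀ u → partner N u ≡ partner N′ u
    σ-injective {N} {N′} path path′ σ≡ u with partner N u Fin.≟ partner N′ u
    ... | yes same = same
    ... | no differ with partner N u Fin.≟ partner M₀ u | partner N′ u Fin.≟ partner M₀ u
    ...   | yes fixed | yes fixed′ = contradiction (trans fixed (sym fixed′)) differ
    ...   | no moved | yes fixed′ = contradiction fixed′ (σ-⊆-preserves-moved path (Equivalence.to ∘ σ≡) moved)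
    ...   | yes fixed | no moved′ = contradiction fixed (σ-⊆-preserves-moved path′ (Equivalence.from ∘ σ≡) moved′)
    ...   | no moved | no moved′ = ⊥-elim (both-moved (moved-face path moved) (moved-face path′ moved′))
      where
      both-moved : ∃ (λ h → σ G white M₀ N h × u ∈ h × partner N u ∈ h) →
                   ∃ (λ h → σ G white M₀ N′ h × u ∈ h × partner N′ u ∈ h) → ⊥
      both-moved (h , σh , u∈h , x∈h) (h′ , σh′ , u∈h′ , x′∈h′)
        with Equivalence.to (σ≡ h) σh | Equivalence.from (σ≡ h′) σh′
      ... | _ , C′ , h⊆C′ | _ , C , h′⊆C =
        partners-on-both-cycles C C′ (h′⊆C u u∈h′) (h′⊆C _ x′∈h′) (h⊆C′ u u∈h) (h⊆C′ _ x∈h) differ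

lemma5p3 : (n : ℕ) (G : Outerplane2Conn n) (white : Fin n → Bool) →
    ProperColoring G white →
    (M₀ : PerfectMatching G) → IsLeast G white M₀ →
    ((M : PerfectMatching G) → IsOrderIdeal G white (σ G white M₀ M))
    × ((M M' : PerfectMatching G) →
       (∀ S → σ G white M₀ M S ⇔ σ G white M₀ M' S) →
       ∀ u → partner M u ≡ partner M' u)
lemma5p3 zero G _ _ _ _ with Outerplane2Conn.three≤n G
... | ()
lemma5p3 (suc m) G white proper M₀ least =
  σ-isOrderIdeal outerM₀ , λ M M′ → σ-injective outerM₀ (least M) (least M′)
  where
  open Outerplane G white proper
  outerM₀ : BlackToWhiteOuter M₀
  outerM₀ = least-blackToWhite least
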